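{- Let $n \ge d \ge 1$ be integers. Then $H_{\mathrm{s}}(n,d)$ equals the length (number of edges) of the longest induced path in the Johnson graph $J(n,d)$.
   Context: A pure simplicial complex of dimension $d-1$ (a $(d-1)$-complex) on $[n]=\{1,\dots,n\}$ is a nonempty family $C$ of $d$-element subsets of $[n]$, called facets. Its adjacency (dual) graph $G(C)$ has the facets of $C$ as vertices, two facets $X,Y$ being adjacent when $|X\setminus Y|=1$. $C$ is strongly connected if $G(C)$ is connected. The diameter of $C$ is the diameter of $G(C)$. $H_{\mathrm{s}}(n,d)$ denotes the maximum diameter of strongly connected $(d-1)$-complexes on $[n]$. The Johnson graph $J(n,d)$ is the adjacency graph of the family of all $d$-subsets of $[n]$. -}

module Defs where

open import Data.Nat using (ℕ; zero; suc; _≤_)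
open import Data.Fin using (Fin; toℕ; zero; fromℕ)
open import Data.Fin.Subset using (Subset; _─_; ∣_∣)
open import Data.List using (List; []; _∷_)
open import Data.List.Relation.Unary.All using (All)
open import Data.List.Relation.Unary.Unique.Propositional using (Unique)
import Data.List.Membership.Propositional as L
open import Data.Product using (Σ; _×_; ∃)
open import Data.Sum using (_⊎_)
open import Relation.Binary.PropositionalEquality using (_≡_; _≢_)
open import Relation.Nullary using (¬_)
open import Function.Definitions using (Injective)

Adj : {n : ℕ} → Subset n → Subset n → Set
Adj X Y = ∣ X ─ Y ∣ ≡ 1

-- A pure (d-1)-complex on [n]: a nonempty family (duplicate-free list,
-- order irrelevant) of d-element subsets of [n].
record Complex (n d : ℕ) : Set where
  field
    facets   : List (Subset n)
    nonempty : facets ≢ []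
    distinct : Unique facets
    pure     : All (λ X → ∣ X ∣ ≡ d) facets
open Complex public

data Walk {n d : ℕ} (C : Complex n d) : Subset n → Subset n → ℕ → Set where
  stay : ∀ {X} → X L.∈ facets C → Walk C X X 0
  step : ∀ {X Y Z k} → X L.∈ facets C → Adj X Y → Walk C Y Z k → Walk C X Z (suc k)

Dist : {n d : ℕ} → Complex n d → Subset n → Subset n → ℕ → Set
Dist C X Y k = Walk C X Y k × (∀ m → Walk C X Y m → k ≤ m)

StronglyConnected : {n d : ℕ} → Complex n d → Set
StronglyConnected C = ∀ X Y → X L.∈ facets C → Y L.∈ facets C → ∃ λ k → Walk C X Y k

Diameter : {n d : ℕ} → Complex n d → ℕ → Set
Diameter C D =
  StronglyConnected C
  × (∀ X Y k → Dist C X Y k → k ≤ D)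
  × Σ (Subset _) λ X → Σ (Subset _) λ Y → X L.∈ facets C × Y L.∈ facets C × Dist C X Y D

IsHs : ℕ → ℕ → ℕ → Set
IsHs n d h =
  (Σ (Complex n d) λ C → StronglyConnected C × Diameter C h)
  × (∀ (C : Complex n d) D → StronglyConnected C → Diameter C D → D ≤ h)

record InducedPath (n d L : ℕ) : Set where
  field
    vert     : Fin (suc L) → Subset n
    size     : ∀ i → ∣ vert i ∣ ≡ d
    injective : Injective _≡_ _≡_ vert
    consec   : ∀ i j → toℕ j ≡ suc (toℕ i) → Adj (vert i) (vert j)
    induced  : ∀ i j → Adj (vert i) (vert j) → toℕ j ≡ suc (toℕ i) ⊎ toℕ i ≡ suc (toℕ j)

IsLongestInducedPathLength : ℕ → ℕ → ℕ → Set
IsLongestInducedPathLength n d L =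
  InducedPath n d L × (∀ M → InducedPath n d M → M ≤ L)

-- A shortest walk realising the diameter D of a strongly connected complex
-- visits D + 1 facets that form an induced path of J(n,d): a repeated facet
-- or an adjacency between two non-consecutive facets of the walk would give
-- a shorter walk.  Conversely, the facets of an induced path of length L form
-- a strongly connected complex whose adjacency graph is that path, so its
-- diameter is L.  A longest induced path exists because being an induced path
-- is decidable and an induced path has at most 2 ^ n vertices.
module Submission where

open import Defs
open import Data.Bool using (Bool; true; false)
import Data.Bool as Bool
open import Data.Empty using (⊥-elim)
open import Data.Fin using (Fin; zero; suc; toℕ; combine)
import Data.Fin.Properties as Finₚ
open import Data.Fin.Subset using (Subset; _─_; ∣_∣; inside; outside)
open import Data.Fin.Subset.Properties using (anySubset?)
import Data.List as List
import Data.List.Relation.Unary.All as All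
import Data.List.Relation.Unary.All.Properties as Allₚ
import Data.List.Relation.Unary.Unique.Propositional.Properties as Uniqueₚ
open import Data.List.Membership.Propositional using (_∈_)
open import Data.List.Membership.Propositional.Properties using (∈-tabulate⁺; ∈-tabulate⁻)
open import Data.Nat using (ℕ; zero; suc; _+_; _∸_; _^_; _≤_; _<_; z≤n; s≤s; s≤s⁻¹)
import Data.Nat as ℕ
open import Data.Nat.Properties
open import Data.Product using (Σ; ∃; _×_; _,_)
open import Data.Sum using (_⊎_; inj₁; inj₂)
open import Data.Vec using (Vec; []; _∷_; lookup; tabulate)
open import Data.Vec.Properties using (lookup∘tabulate; ≡-dec)
open import Function using (_∘_)
open import Function.Definitions using (Injective)
open import Level using (Level)
open import Relation.Binary.PropositionalEquality
open import Relation.Binary.Definitions using (tri<; tri≈; tri>)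
open import Relation.Nullary using (¬_; Dec; yes; no)
open import Relation.Nullary.Decidable using (map′; _×-dec_; _⊎-dec_; _→-dec_)
open import Relation.Unary using (Pred; Decidable)

private
  variable
    ℓ : Level
    n d L : ℕ

∣p∣+∣q─p∣≡∣q∣+∣p─q∣ : (p q : Subset n) → ∣ p ∣ + ∣ q ─ p ∣ ≡ ∣ q ∣ + ∣ p ─ q ∣
∣p∣+∣q─p∣≡∣q∣+∣p─q∣ []            []            = refl
∣p∣+∣q─p∣≡∣q∣+∣p─q∣ (outside ∷ p) (outside ∷ q) = ∣p∣+∣q─p∣≡∣q∣+∣p─q∣ p q
∣p∣+∣q─p∣≡∣q∣+∣p─q∣ (inside  ∷ p) (inside  ∷ q) = cong suc (∣p∣+∣q─p∣≡∣q∣+∣p─q∣ p q)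
∣p∣+∣q─p∣≡∣q∣+∣p─q∣ (inside  ∷ p) (outside ∷ q) =
  trans (cong suc (∣p∣+∣q─p∣≡∣q∣+∣p─q∣ p q)) (sym (+-suc ∣ q ∣ _))
∣p∣+∣q─p∣≡∣q∣+∣p─q∣ (outside ∷ p) (inside  ∷ q) =
  trans (+-suc ∣ p ∣ _) (cong suc (∣p∣+∣q─p∣≡∣q∣+∣p─q∣ p q))

Adj-sym : {p q : Subset n} → ∣ p ∣ ≡ ∣ q ∣ → Adj p q → Adj q p
Adj-sym {p = p} {q} ∣p∣≡∣q∣ p~q = +-cancelˡ-≡ ∣ p ∣ _ _ (begin
  ∣ p ∣ + ∣ q ─ p ∣  ≡⟨ ∣p∣+∣q─p∣≡∣q∣+∣p─q∣ p q ⟩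
  ∣ q ∣ + ∣ p ─ q ∣  ≡⟨ cong₂ _+_ (sym ∣p∣≡∣q∣) p~q ⟩
  ∣ p ∣ + 1          ∎)
  where open ≡-Reasoning

∣p─p∣≡0 : (p : Subset n) → ∣ p ─ p ∣ ≡ 0
∣p─p∣≡0 []            = refl
∣p─p∣≡0 (outside ∷ p) = ∣p─p∣≡0 p
∣p─p∣≡0 (inside  ∷ p) = ∣p─p∣≡0 p

Adj-irrefl : (p : Subset n) → ¬ Adj p p
Adj-irrefl p p~p = 0≢1+n (trans (sym (∣p─p∣≡0 p)) p~p)

∃-subset-of-size : d ≤ n → ∃ λ (p : Subset n) → ∣ p ∣ ≡ d
∃-subset-of-size {n = zero}  z≤n       = [] , refl
∃-subset-of-size {n = suc n} z≤n       with ∃-subset-of-size {n = n} z≤n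
... | p , ∣p∣≡0 = outside ∷ p , ∣p∣≡0
∃-subset-of-size {n = suc n} (s≤s d≤n) with ∃-subset-of-size d≤n
... | p , ∣p∣≡d = inside ∷ p , cong suc ∣p∣≡d

module _ {n d : ℕ} {C : Complex n d} where

  facet-size : ∀ {X} → X ∈ facets C → ∣ X ∣ ≡ d
  facet-size = All.lookup (pure C)

  source-∈ : ∀ {X Y k} → Walk C X Y k → X ∈ facets C
  source-∈ (stay X∈)     = X∈
  source-∈ (step X∈ _ _) = X∈

  target-∈ : ∀ {X Y k} → Walk C X Y k → Y ∈ facets C
  target-∈ (stay Y∈)    = Y∈
  target-∈ (step _ _ w) = target-∈ w

  _++_ : ∀ {X Y Z a b} → Walk C X Y a → Walk C Y Z b → Walk C X Z (a + b)
  stay _       ++ v = v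
  step X∈ a w ++ v = step X∈ a (w ++ v)

  snoc : ∀ {X Y Z k} → Walk C X Y k → Adj Y Z → Z ∈ facets C → Walk C X Z (suc k)
  snoc (stay Y∈)       Y~Z Z∈ = step Y∈ Y~Z (stay Z∈)
  snoc (step X∈ X~W w) Y~Z Z∈ = step X∈ X~W (snoc w Y~Z Z∈)

  facet-Adj-sym : ∀ {X Y} → X ∈ facets C → Y ∈ facets C → Adj X Y → Adj Y X
  facet-Adj-sym {X} {Y} X∈ Y∈ = Adj-sym {p = X} {Y} (trans (facet-size X∈) (sym (facet-size Y∈)))

  reverse : ∀ {X Y k} → Walk C X Y k → Walk C Y X k
  reverse (stay X∈)       = stay X∈
  reverse (step X∈ X~W w) = snoc (reverse w) (facet-Adj-sym X∈ (source-∈ w) X~W) X∈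

  -- The i-th facet of a walk; indices past the end give its last facet.
  vertex : ∀ {X Y k} → Walk C X Y k → ℕ → Subset n
  vertex (stay {X} _)       _       = X
  vertex (step {X} _ _ _)   zero    = X
  vertex (step _ _ w)       (suc i) = vertex w i

  vertex-∈ : ∀ {X Y k} (w : Walk C X Y k) i → vertex w i ∈ facets C
  vertex-∈ (stay X∈)     _       = X∈
  vertex-∈ (step X∈ _ _) zero    = X∈
  vertex-∈ (step _ _ w)  (suc i) = vertex-∈ w i

  vertex-adj : ∀ {X Y k} (w : Walk C X Y k) i → suc i ≤ k → Adj (vertex w i) (vertex w (suc i))
  vertex-adj (step _ X~W (stay _))       zero    _         = X~W
  vertex-adj (step _ X~W (step _ _ _))   zero    _         = X~W
  vertex-adj (step _ _ w)                (suc i) (s≤s i<k) = vertex-adj w i i<k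

  take : ∀ {X Y k} (w : Walk C X Y k) i → i ≤ k → Walk C X (vertex w i) i
  take (stay X∈)       zero    _         = stay X∈
  take (step X∈ _ _)   zero    _         = stay X∈
  take (step X∈ X~W w) (suc i) (s≤s i≤k) = step X∈ X~W (take w i i≤k)

  drop : ∀ {X Y k} (w : Walk C X Y k) i → Walk C (vertex w i) Y (k ∸ i)
  drop (stay Y∈)    zero    = stay Y∈
  drop (stay Y∈)    (suc i) = stay Y∈
  drop w@(step _ _ _) zero  = w
  drop (step _ _ w) (suc i) = drop w i

  geodesic-shortcut : ∀ {X Y D} ((w , _) : Dist C X Y D) {i j m} → i ≤ j → j ≤ D →
                      Walk C (vertex w i) (vertex w j) m → j ≤ i + m
  geodesic-shortcut {D = D} (w , minimal) {i} {j} {m} i≤j j≤D v =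
    +-cancelʳ-≤ (D ∸ j) j (i + m) (begin
      j + (D ∸ j)        ≡⟨ m+[n∸m]≡n j≤D ⟩
      D                  ≤⟨ minimal _ (take w i (≤-trans i≤j j≤D) ++ (v ++ drop w j)) ⟩
      i + (m + (D ∸ j))  ≡⟨ +-assoc i m (D ∸ j) ⟨
      i + m + (D ∸ j)    ∎)
    where open ≤-Reasoning

  geodesic⇒InducedPath : ∀ {X Y D} → Dist C X Y D → InducedPath n d D
  geodesic⇒InducedPath {D = D} dist@(w , _) = record
    { vert      = vert
    ; size      = λ i → facet-size (vertex-∈ w (toℕ i))
    ; injective = injective
    ; consec    = consec
    ; induced   = induced
    }
    where
    vert : Fin (suc D) → Subset n
    vert i = vertex w (toℕ i)

    ≤D : (i : Fin (suc D)) → toℕ i ≤ D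
    ≤D = Finₚ.toℕ≤pred[n]

    no-repeat : ∀ {i j} → i < j → j ≤ D → vertex w i ≢ vertex w j
    no-repeat {i} {j} i<j j≤D wᵢ≡wⱼ = <⇒≱ i<j (begin
      j      ≤⟨ geodesic-shortcut dist (<⇒≤ i<j) j≤D
                  (subst (λ Z → Walk C (vertex w i) Z 0) wᵢ≡wⱼ (stay (vertex-∈ w i))) ⟩
      i + 0  ≡⟨ +-identityʳ i ⟩
      i      ∎)
      where open ≤-Reasoning

    no-chord : ∀ {i j} → i < j → j ≤ D → Adj (vertex w i) (vertex w j) → j ≡ suc i
    no-chord {i} {j} i<j j≤D wᵢ~wⱼ = ≤-antisym (begin
      j      ≤⟨ geodesic-shortcut dist (<⇒≤ i<j) j≤D
                  (step (vertex-∈ w i) wᵢ~wⱼ (stay (vertex-∈ w j))) ⟩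
      i + 1  ≡⟨ +-comm i 1 ⟩
      suc i  ∎) i<j
      where open ≤-Reasoning

    injective : Injective _≡_ _≡_ vert
    injective {i} {j} vᵢ≡vⱼ with <-cmp (toℕ i) (toℕ j)
    ... | tri< i<j _ _ = ⊥-elim (no-repeat i<j (≤D j) vᵢ≡vⱼ)
    ... | tri≈ _ i≡j _ = Finₚ.toℕ-injective i≡j
    ... | tri> _ _ j<i = ⊥-elim (no-repeat j<i (≤D i) (sym vᵢ≡vⱼ))

    consec : ∀ i j → toℕ j ≡ suc (toℕ i) → Adj (vert i) (vert j)
    consec i j j≡1+i = subst (λ k → Adj (vert i) (vertex w k)) (sym j≡1+i)
      (vertex-adj w (toℕ i) (subst (_≤ D) j≡1+i (≤D j)))

    induced : ∀ i j → Adj (vert i) (vert j) → toℕ j ≡ suc (toℕ i) ⊎ toℕ i ≡ suc (toℕ j)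
    induced i j vᵢ~vⱼ with <-cmp (toℕ i) (toℕ j)
    ... | tri< i<j _ _ = inj₁ (no-chord i<j (≤D j) vᵢ~vⱼ)
    ... | tri≈ _ i≡j _ = ⊥-elim (Adj-irrefl (vert j)
                           (subst (λ k → Adj (vert k) (vert j)) (Finₚ.toℕ-injective i≡j) vᵢ~vⱼ))
    ... | tri> _ _ j<i = inj₂ (no-chord j<i (≤D i)
                           (facet-Adj-sym (vertex-∈ w (toℕ i)) (vertex-∈ w (toℕ j)) vᵢ~vⱼ))

clamp : (L : ℕ) → ℕ → Fin (suc L)
clamp L       zero    = zero
clamp zero    (suc i) = zero
clamp (suc L) (suc i) = suc (clamp L i)

toℕ-clamp : ∀ L {i} → i ≤ L → toℕ (clamp L i) ≡ i
toℕ-clamp L       {zero}  _         = refl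
toℕ-clamp (suc L) {suc i} (s≤s i≤L) = cong suc (toℕ-clamp L i≤L)

clamp-toℕ : ∀ L (i : Fin (suc L)) → clamp L (toℕ i) ≡ i
clamp-toℕ L       zero    = refl
clamp-toℕ (suc L) (suc i) = cong suc (clamp-toℕ L i)

module PathComplex {n d L : ℕ} (P : InducedPath n d L) where
  open InducedPath P

  complex : Complex n d
  complex = record
    { facets   = List.tabulate vert
    ; nonempty = λ ()
    ; distinct = Uniqueₚ.tabulate⁺ injective
    ; pure     = Allₚ.tabulate⁺ {f = vert} size
    }

  vert-∈ : ∀ i → vert i ∈ facets complex
  vert-∈ = ∈-tabulate⁺

  ∈⇒vert : ∀ {X} → X ∈ facets complex → ∃ λ i → X ≡ vert i
  ∈⇒vert = ∈-tabulate⁻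

  path : ℕ → Subset n
  path a = vert (clamp L a)

  path-toℕ : ∀ i → path (toℕ i) ≡ vert i
  path-toℕ i = cong vert (clamp-toℕ L i)

  path-adj : ∀ a → suc a ≤ L → Adj (path a) (path (suc a))
  path-adj a a<L = consec _ _ (begin
    toℕ (clamp L (suc a))  ≡⟨ toℕ-clamp L a<L ⟩
    suc a                  ≡⟨ cong suc (toℕ-clamp L (<⇒≤ a<L)) ⟨
    suc (toℕ (clamp L a))  ∎)
    where open ≡-Reasoning

  along : ∀ a m → a + m ≤ L → Walk complex (path a) (path (a + m)) m
  along a zero    _     rewrite +-identityʳ a = stay (vert-∈ _)
  along a (suc m) a+m<L rewrite +-suc a m     =
    step (vert-∈ _) (path-adj a (≤-trans (s≤s (m≤m+n a m)) a+m<L)) (along (suc a) m a+m<L)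

  walk-up : ∀ {i j} → toℕ i ≤ toℕ j → Walk complex (vert i) (vert j) (toℕ j ∸ toℕ i)
  walk-up {i} {j} i≤j =
    subst₂ (λ X Y → Walk complex X Y (toℕ j ∸ toℕ i))
      (path-toℕ i) (trans (cong path i+[j∸i]≡j) (path-toℕ j))
      (along (toℕ i) (toℕ j ∸ toℕ i) (subst (_≤ L) (sym i+[j∸i]≡j) (Finₚ.toℕ≤pred[n] j)))
    where
    i+[j∸i]≡j : toℕ i + (toℕ j ∸ toℕ i) ≡ toℕ j
    i+[j∸i]≡j = m+[n∸m]≡n i≤j

  walk-between : ∀ i j → ∃ λ k → k ≤ L × Walk complex (vert i) (vert j) k
  walk-between i j with ≤-total (toℕ i) (toℕ j)
  ... | inj₁ i≤j = _ , ≤-trans (m∸n≤m (toℕ j) (toℕ i)) (Finₚ.toℕ≤pred[n] j) , walk-up i≤j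
  ... | inj₂ j≤i = _ , ≤-trans (m∸n≤m (toℕ i) (toℕ j)) (Finₚ.toℕ≤pred[n] i) , reverse (walk-up j≤i)

  adjacent-index : ∀ {i j} → Adj (vert i) (vert j) → toℕ j ≤ suc (toℕ i)
  adjacent-index {i} {j} vᵢ~vⱼ with induced i j vᵢ~vⱼ
  ... | inj₁ j≡1+i = ≤-reflexive j≡1+i
  ... | inj₂ i≡1+j = m≤n⇒m≤1+n (≤-trans (n≤1+n (toℕ j)) (≤-reflexive (sym i≡1+j)))

  walk-length-≥ : ∀ {X Y m i j} → Walk complex X Y m → X ≡ vert i → Y ≡ vert j →
                  toℕ j ≤ toℕ i + m
  walk-length-≥ {i = i} (stay _) X≡vᵢ X≡vⱼ =
    ≤-reflexive (sym (trans (+-identityʳ (toℕ i)) (cong toℕ (injective (trans (sym X≡vᵢ) X≡vⱼ)))))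
  walk-length-≥ {m = suc m} {i} {j} (step _ X~Z w) X≡vᵢ Y≡vⱼ with ∈⇒vert (source-∈ w)
  ... | k , Z≡vₖ = begin
    toℕ j             ≤⟨ walk-length-≥ w Z≡vₖ Y≡vⱼ ⟩
    toℕ k + m         ≤⟨ +-monoˡ-≤ m (adjacent-index (subst₂ Adj X≡vᵢ Z≡vₖ X~Z)) ⟩
    suc (toℕ i) + m   ≡⟨ +-suc (toℕ i) m ⟨
    toℕ i + suc m     ∎
    where open ≤-Reasoning

  strongly-connected : StronglyConnected complex
  strongly-connected X Y X∈ Y∈ with ∈⇒vert X∈ | ∈⇒vert Y∈
  ... | i , refl | j , refl with walk-between i j
  ... | k , _ , w = k , w

  diameter : Diameter complex L
  diameter = strongly-connected , bounded , path 0 , path L , vert-∈ _ , vert-∈ _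
           , along 0 L ≤-refl , ends-far-apart
    where
    bounded : ∀ X Y k → Dist complex X Y k → k ≤ L
    bounded X Y k (w , minimal) with ∈⇒vert (source-∈ w) | ∈⇒vert (target-∈ w)
    ... | i , refl | j , refl with walk-between i j
    ... | k′ , k′≤L , w′ = ≤-trans (minimal k′ w′) k′≤L

    ends-far-apart : ∀ m → Walk complex (path 0) (path L) m → L ≤ m
    ends-far-apart m w = subst (_≤ m) (toℕ-clamp L ≤-refl) (walk-length-≥ w refl refl)

bit : Bool → Fin 2
bit false = zero
bit true  = suc zero

bit-injective : Injective _≡_ _≡_ bit
bit-injective {false} {false} _ = refl
bit-injective {true}  {true}  _ = refl

encode : Subset n → Fin (2 ^ n)
encode []      = zero
encode (b ∷ p) = combine (bit b) (encode p)

encode-injective : Injective _≡_ _≡_ (encode {n})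
encode-injective {x = []}    {[]}    _ = refl
encode-injective {x = a ∷ p} {b ∷ q} e with Finₚ.combine-injective (bit a) (encode p) (bit b) (encode q) e
... | a≡b , p≡q = cong₂ _∷_ (bit-injective a≡b) (encode-injective p≡q)

InducedPath⇒≤2^n : InducedPath n d L → suc L ≤ 2 ^ n
InducedPath⇒≤2^n P = Finₚ.injective⇒≤ (InducedPath.injective P ∘ encode-injective)

trivial-InducedPath : d ≤ n → InducedPath n d 0
trivial-InducedPath d≤n with ∃-subset-of-size d≤n
... | p , ∣p∣≡d = record
  { vert      = λ _ → p
  ; size      = λ _ → ∣p∣≡d
  ; injective = λ { {zero} {zero} _ → refl }
  ; consec    = λ { zero zero () }
  ; induced   = λ _ _ p~p → ⊥-elim (Adj-irrefl p p~p)
  }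

IsInducedPath : (d : ℕ) → (Fin (suc L) → Subset n) → Set
IsInducedPath d f =
  (∀ i → ∣ f i ∣ ≡ d)
  × (∀ i j → f i ≡ f j → i ≡ j)
  × (∀ i j → toℕ j ≡ suc (toℕ i) → Adj (f i) (f j))
  × (∀ i j → Adj (f i) (f j) → toℕ j ≡ suc (toℕ i) ⊎ toℕ i ≡ suc (toℕ j))

isInducedPath? : (d : ℕ) (f : Fin (suc L) → Subset n) → Dec (IsInducedPath d f)
isInducedPath? d f =
  Finₚ.all? (λ i → ∣ f i ∣ ℕ.≟ d)
  ×-dec Finₚ.all? (λ i → Finₚ.all? λ j → ≡-dec Bool._≟_ (f i) (f j) →-dec i Finₚ.≟ j)
  ×-dec Finₚ.all? (λ i → Finₚ.all? λ j → toℕ j ℕ.≟ suc (toℕ i) →-dec adj? (f i) (f j))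
  ×-dec Finₚ.all? (λ i → Finₚ.all? λ j →
          adj? (f i) (f j) →-dec (toℕ j ℕ.≟ suc (toℕ i) ⊎-dec toℕ i ℕ.≟ suc (toℕ j)))
  where
  adj? : (p q : Subset _) → Dec (Adj p q)
  adj? p q = ∣ p ─ q ∣ ℕ.≟ 1

IsInducedPath-resp-≗ : {f g : Fin (suc L) → Subset n} → f ≗ g →
                       IsInducedPath d f → IsInducedPath d g
IsInducedPath-resp-≗ f≗g (size , injective , consec , induced) =
    (λ i → trans (cong ∣_∣ (sym (f≗g i))) (size i))
  , (λ i j gᵢ≡gⱼ → injective i j (trans (f≗g i) (trans gᵢ≡gⱼ (sym (f≗g j)))))
  , (λ i j j≡1+i → subst₂ Adj (f≗g i) (f≗g j) (consec i j j≡1+i))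
  , (λ i j gᵢ~gⱼ → induced i j (subst₂ Adj (sym (f≗g i)) (sym (f≗g j)) gᵢ~gⱼ))

any-Vec? : {A : Set} → (∀ {P : Pred A ℓ} → Decidable P → Dec (∃ P)) →
           ∀ k {P : Pred (Vec A k) ℓ} → Decidable P → Dec (∃ P)
any-Vec? any? zero    P? = map′ ([] ,_) (λ { ([] , p) → p }) (P? [])
any-Vec? any? (suc k) P? =
  map′ (λ (x , xs , p) → x ∷ xs , p) (λ { (x ∷ xs , p) → x , xs , p })
       (any? λ x → any-Vec? any? k (P? ∘ (x ∷_)))

InducedPath? : (n d L : ℕ) → Dec (InducedPath n d L)
InducedPath? n d L =
  map′ (λ (_ , h) → fromIsInducedPath h) toIsInducedPath
       (any-Vec? anySubset? (suc L) (isInducedPath? d ∘ lookup))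
  where
  fromIsInducedPath : {f : Fin (suc L) → Subset n} → IsInducedPath d f → InducedPath n d L
  fromIsInducedPath {f} (size , injective , consec , induced) = record
    { vert = f ; size = size ; injective = injective _ _ ; consec = consec ; induced = induced }

  toIsInducedPath : InducedPath n d L → ∃ λ v → IsInducedPath d (lookup v)
  toIsInducedPath P = tabulate vert , IsInducedPath-resp-≗ (sym ∘ lookup∘tabulate vert)
    (size , (λ _ _ → injective) , consec , induced)
    where open InducedPath P

maximum-of-bounded : {P : Pred ℕ ℓ} → Decidable P → ∀ {m} → P m → ∀ k →
                     (∀ m → P m → m ≤ k) → ∃ λ h → P h × (∀ m → P m → m ≤ h)
maximum-of-bounded {P = P} P? Pm zero    bound = 0 , subst P (n≤0⇒n≡0 (bound _ Pm)) Pm , bound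
maximum-of-bounded         P? Pm (suc k) bound with P? (suc k)
... | yes Pk = suc k , Pk , bound
... | no ¬Pk = maximum-of-bounded P? Pm k λ m Pm′ →
                 s≤s⁻¹ (≤∧≢⇒< (bound m Pm′) λ { refl → ¬Pk Pm′ })

longest-InducedPath : d ≤ n → ∃ (IsLongestInducedPathLength n d)
longest-InducedPath {d} {n} d≤n =
  maximum-of-bounded (InducedPath? n d) (trivial-InducedPath d≤n) (2 ^ n)
    λ L P → ≤-trans (n≤1+n L) (InducedPath⇒≤2^n P)

proposition2p5 : (n d : ℕ) → 1 ≤ d → d ≤ n →
    Σ ℕ λ h → IsHs n d h × IsLongestInducedPathLength n d h
proposition2p5 n d _ d≤n with longest-InducedPath d≤n
... | L , P , longest =
  L , ( (complex , strongly-connected , diameter)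
      , (λ C D _ (_ , _ , _ , _ , _ , _ , dist) → longest D (geodesic⇒InducedPath dist)) )
    , P , longest
  where open PathComplex P
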